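{- Let $n\ge 1$, let $S\subseteq \{1,2,\ldots,\lfloor n/2\rfloor\}$, and let $G=C_n(S)$. Assume there exists $a\in S$ whose additive order $k=\operatorname{ord}(a)$ in $\mathbb{Z}_n$ satisfies $k\geq 4$ and such that \[\Big\{a,2a,\ldots,\Big\lfloor \frac{k}{2}\Big\rfloor a\Big\}\nsubseteq S.\] Then $G$ is not chordal.
   Context: For $S\subseteq T:=\{1,2,\ldots,\lfloor n/2\rfloor\}$, the circulant graph $C_n(S)$ has vertex set $\mathbb{Z}_n=\{0,\ldots,n-1\}$ and edge set $\{\{i,j\} : |j-i|_n\in S\}$, where $|k|_n=\min\{|k|,n-|k|\}$. Multiples $ja$ are computed in $\mathbb{Z}_n$, and an element $x\in\mathbb{Z}_n$ is regarded as belonging to $S$ when its labelling distance $|x|_n$ lies in $S$. $\operatorname{ord}(a)=n/\gcd(a,n)$ is the additive order of $a$ in $\mathbb{Z}_n$. A graph is chordal if every cycle of length at least $4$ has a chord, i.e. an edge not in the cycle joining two of its vertices. -}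

module Defs where

open import Data.Nat using (ℕ; zero; suc; _+_; _*_; _∸_; _≤_; _<_; NonZero; ∣_-_∣; _⊓_)
open import Data.Nat.DivMod using (_/_; _%_)
open import Data.Nat.GCD using (gcd)
open import Data.Fin using (Fin; toℕ; inject₁; fromℕ) renaming (zero to fzero; suc to fsuc)
open import Data.Product using (Σ; ∃; _×_; _,_)
open import Data.Sum using (_⊎_)
open import Relation.Nullary using (¬_)
open import Relation.Binary.PropositionalEquality using (_≡_; _≢_)
open import Function.Definitions using (Injective)

labDist : ℕ → ℕ → ℕ
labDist n k = k ⊓ (n ∸ k)

cdist : ℕ → ℕ → ℕ → ℕ
cdist n i j = labDist n ∣ j - i ∣

IsConnSet : ℕ → (ℕ → Set) → Set
IsConnSet n S = ∀ s → S s → (1 ≤ s) × (s ≤ n / 2)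

-- adjacency in the circulant graph C_n(S), vertex set Fin n ≅ ℤ_n
Adj : (n : ℕ) → (S : ℕ → Set) → Fin n → Fin n → Set
Adj n S x y = S (cdist n (toℕ x) (toℕ y))

-- A cycle of length (suc m) in C_n(S): distinct vertices v 0, ..., v m
-- with v i ~ v (i+1) and v m ~ v 0.
IsCycle : (n : ℕ) → (S : ℕ → Set) → (m : ℕ) → (Fin (suc m) → Fin n) → Set
IsCycle n S m v =
  Injective _≡_ _≡_ v
  × (∀ (i : Fin m) → Adj n S (v (inject₁ i)) (v (fsuc i)))
  × Adj n S (v (fromℕ m)) (v fzero)

CycConsec : (m : ℕ) → Fin (suc m) → Fin (suc m) → Set
CycConsec m i j =
  (toℕ j ≡ suc (toℕ i)) ⊎ (toℕ i ≡ suc (toℕ j))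
  ⊎ ((toℕ i ≡ 0) × (toℕ j ≡ m)) ⊎ ((toℕ i ≡ m) × (toℕ j ≡ 0))

HasChord : (n : ℕ) → (S : ℕ → Set) → (m : ℕ) → (Fin (suc m) → Fin n) → Set
HasChord n S m v =
  Σ (Fin (suc m)) λ i → Σ (Fin (suc m)) λ j →
    (i ≢ j) × ¬ CycConsec m i j × Adj n S (v i) (v j)

-- chordal: every cycle of length ≥ 4 (i.e. suc m with m ≥ 3) has a chord
Chordal : (n : ℕ) → (S : ℕ → Set) → Set
Chordal n S = ∀ (m : ℕ) → 3 ≤ m → (v : Fin (suc m) → Fin n) → IsCycle n S m v → HasChord n S m v

-- additive order of a in ℤ_n: n / gcd(a, n)  (gcd = 0 only if a = n = 0)
ord : ℕ → ℕ → ℕ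
ord n a with gcd a n
... | zero = 0
... | suc g = n / suc g

mulMod : (n : ℕ) → .{{NonZero n}} → ℕ → ℕ → ℕ
mulMod n j a = (j * a) % n

module Submission where

-- The vertices 0, a, ..., (k-1)·a are distinct, and x·a ~ y·a iff
-- (y-x)·a ∈ S.  Assuming chordality we prove d·a ∈ S for all 1 ≤ d < k,
-- contradicting j·a ∉ S.  We know 1·a ∈ S and, as (k-d)·a = -(d·a),
-- (k-1)·a ∈ S.  If d·a ∈ S for 1 ≤ d < t and L·a ∈ S with t < L < k, pick
-- stepping stones 0 = P₀ < ... < P_M = L (M ≥ 3) with consecutive gaps < t
-- and all other gaps ≥ t; the P_i·a form a cycle of length ≥ 4 whose chord
-- yields D·a ∈ S with t ≤ D < L.  Descending from L = k-1 gives t·a ∈ S,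
-- and strong induction on t concludes.

open import Defs
open import Data.Nat
open import Data.Nat.Properties
open import Data.Nat.DivMod
open import Data.Nat.Divisibility using (_∣_; ∣⇒≤; *-cancelʳ-∣; m%n≡0⇒n∣m)
open import Data.Nat.GCD using (gcd; gcd[m,n]∣m; gcd[m,n]∣n; gcd[m,n]≡0⇒n≡0)
open import Data.Nat.Coprimality using (Coprime; coprime-divisor; coprime-/gcd)
  renaming (sym to coprime-sym)
open import Data.Nat.Induction using (<-rec)
open import Algebra.Properties.CommutativeSemigroup *-commutativeSemigroup
  using (x∙yz≈y∙xz; x∙yz≈yx∙z)
open import Data.Fin using (Fin; toℕ; fromℕ<; inject₁; fromℕ) renaming (zero to fzero; suc to fsuc)
open import Data.Fin.Properties using (toℕ-fromℕ<; toℕ-inject₁; toℕ-fromℕ; toℕ-injective; toℕ<n)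
open import Data.Product using (Σ; _×_; _,_; proj₁; proj₂)
open import Data.Sum using (inj₁; inj₂)
open import Data.Empty using (⊥-elim)
open import Function using (id; _∘_)
open import Relation.Nullary using (¬_; yes; no)
open import Relation.Binary.Definitions using (tri<; tri≈; tri>)
open import Relation.Binary.PropositionalEquality

quotient-order : ∀ n a g .{{_ : NonZero g}} .{{_ : NonZero n}} → g ∣ a → g ∣ n →
  Coprime (a / g) (n / g) →
  ((n / g) * a) % n ≡ 0 × (∀ d → 0 < d → d < n / g → (d * a) % n ≢ 0)
quotient-order n a g g∣a g∣n coprime = annihilates , minimal
  where
  a′ = a / g
  k = n / g
  a≡ : a′ * g ≡ a
  a≡ = m/n*n≡m g∣a
  n≡ : k * g ≡ n
  n≡ = m/n*n≡m g∣n

  annihilates : (k * a) % n ≡ 0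
  annihilates = trans (cong (_% n) k·a≡a′·n) (m*n%n≡0 a′ n)
    where
    k·a≡a′·n : k * a ≡ a′ * n
    k·a≡a′·n = begin
      k * a         ≡⟨ cong (k *_) (sym a≡) ⟩
      k * (a′ * g)  ≡⟨ x∙yz≈y∙xz k a′ g ⟩
      a′ * (k * g)  ≡⟨ cong (a′ *_) n≡ ⟩
      a′ * n        ∎
      where open ≡-Reasoning

  -- n ∣ d·a means k·g ∣ (a′·d)·g, so k ∣ a′·d and hence k ∣ d.
  minimal : ∀ d → 0 < d → d < k → (d * a) % n ≢ 0
  minimal d d>0 d<k d·a≡0 = <⇒≱ d<k (∣⇒≤ {{>-nonZero d>0}} k∣d)
    where
    kg∣a′dg : k * g ∣ (a′ * d) * g
    kg∣a′dg = subst₂ _∣_ (sym n≡) (trans (cong (d *_) (sym a≡)) (x∙yz≈yx∙z d a′ g))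
                (m%n≡0⇒n∣m (d * a) n d·a≡0)
    k∣d : k ∣ d
    k∣d = coprime-divisor (coprime-sym coprime) (*-cancelʳ-∣ g kg∣a′dg)

ord-spec : ∀ n a .{{_ : NonZero n}} →
  ((ord n a) * a) % n ≡ 0 × (∀ d → 0 < d → d < ord n a → (d * a) % n ≢ 0)
ord-spec n a with gcd a n in g≡
... | zero = ⊥-elim (≢-nonZero⁻¹ n (gcd[m,n]≡0⇒n≡0 a g≡))
... | suc g = quotient-order n a (suc g)
                (subst (_∣ a) g≡ (gcd[m,n]∣m a n)) (subst (_∣ n) g≡ (gcd[m,n]∣n a n)) coprime
  where
  coprime : Coprime (a / suc g) (n / suc g)
  coprime = subst (λ x → (nz : NonZero x) → Coprime ((a / x) {{nz}}) ((n / x) {{nz}}))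
              g≡ (λ nz → coprime-/gcd a n {{nz}}) _


labDist-reflect : ∀ n r → r ≤ n → labDist n (n ∸ r) ≡ labDist n r
labDist-reflect n r r≤n = trans (cong ((n ∸ r) ⊓_) (m∸[m∸n]≡n r≤n)) (⊓-comm (n ∸ r) r)

double-half : ∀ n r → r ≤ n / 2 → r + r ≤ n
double-half n r r≤n/2 = subst (_≤ n) (trans (*-comm r 2) (cong (r +_) (+-identityʳ r)))
  (≤-trans (*-monoˡ-≤ 2 r≤n/2) (m/n*n≤m n 2))

labDist-half : ∀ n r → r ≤ n / 2 → labDist n r ≡ r
labDist-half n r r≤n/2 = m≤n⇒m⊓n≡m (m+n≤o⇒m≤o∸n r (double-half n r r≤n/2))

cdist-comm : ∀ n u w → cdist n u w ≡ cdist n w u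
cdist-comm n u w = cong (labDist n) (∣-∣-comm w u)

Adj-sym : ∀ n S (u w : Fin n) → Adj n S u w → Adj n S w u
Adj-sym n S u w = subst S (cdist-comm n (toℕ u) (toℕ w))

cdist-shift : ∀ n .{{_ : NonZero n}} u r → u < n → r < n →
  (cdist n u ((u + r) % n) ≡ labDist n r) × (u ≡ (u + r) % n → r ≡ 0)
cdist-shift n u r u<n r<n with u + r <? n
... | yes u+r<n rewrite m<n⇒m%n≡m u+r<n =
  cong (labDist n) (trans (∣-∣-comm (u + r) u) (∣m-m+n∣≡n u r)) ,
  λ u≡u+r → +-cancelˡ-≡ u r 0 (trans (sym u≡u+r) (sym (+-identityʳ u)))
... | no u+r≮n = distance , no-return
  where
  s = n ∸ r
  n≡r+s : n ≡ r + s
  n≡r+s = sym (m+[n∸m]≡n (<⇒≤ r<n))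
  s≤u : s ≤ u
  s≤u = subst (s ≤_) (m+n∸n≡m u r) (∸-monoˡ-≤ r (≮⇒≥ u+r≮n))
  wrap : (u + r) % n ≡ u ∸ s
  wrap = begin
    (u + r) % n            ≡⟨ sym (m≤n⇒[n∸m]%m≡n%m (≮⇒≥ u+r≮n)) ⟩
    (u + r ∸ n) % n        ≡⟨ cong (λ m → (u + r ∸ m) % n) n≡r+s ⟩
    (u + r ∸ (r + s)) % n  ≡⟨ cong (λ m → (m ∸ (r + s)) % n) (+-comm u r) ⟩
    (r + u ∸ (r + s)) % n  ≡⟨ cong (_% n) ([m+n]∸[m+o]≡n∸o r u s) ⟩
    (u ∸ s) % n            ≡⟨ m<n⇒m%n≡m (≤-<-trans (m∸n≤m u s) u<n) ⟩
    u ∸ s                  ∎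
    where open ≡-Reasoning
  distance : cdist n u ((u + r) % n) ≡ labDist n r
  distance rewrite wrap =
    trans (cong (labDist n) (trans (m≤n⇒∣m-n∣≡n∸m (m∸n≤m u s)) (m∸[m∸n]≡n s≤u)))
          (labDist-reflect n r (<⇒≤ r<n))
  no-return : u ≡ (u + r) % n → r ≡ 0
  no-return u≡ = ⊥-elim (<-irrefl (sym (trans u≡ wrap)) (∸-monoʳ-< (m<n⇒0<n∸m r<n) s≤u))

-- A chain P 0, ..., P M whose consecutive gaps lie in [1, mm] and whose
-- gaps over two steps exceed mm; in the orbit cycle built from it, edges
-- come from short gaps and chords from long ones.
module GappedChain (mm M : ℕ) (P : ℕ → ℕ)
  (step : ∀ i → i < M → P i < P (suc i) × P (suc i) ≤ P i + mm)
  (skip : ∀ i → 2 + i ≤ M → P i + suc mm ≤ P (2 + i)) where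

  mono : ∀ i j → i ≤ j → j ≤ M → P i ≤ P j
  mono i zero i≤0 _ = ≤-reflexive (cong P (n≤0⇒n≡0 i≤0))
  mono i (suc j) i≤1+j 1+j≤M with m≤n⇒m<n∨m≡n i≤1+j
  ... | inj₂ refl = ≤-refl
  ... | inj₁ (s≤s i≤j) = ≤-trans (mono i j i≤j (<⇒≤ 1+j≤M)) (<⇒≤ (proj₁ (step j 1+j≤M)))

  strict : ∀ i j → i < j → j ≤ M → P i < P j
  strict i (suc j) (s≤s i≤j) 1+j≤M = ≤-<-trans (mono i j i≤j (<⇒≤ 1+j≤M)) (proj₁ (step j 1+j≤M))

  near : ∀ i → i < M → 1 ≤ P (suc i) ∸ P i × P (suc i) ∸ P i ≤ mm
  near i i<M = m<n⇒0<n∸m (proj₁ (step i i<M)) ,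
               ≤-trans (∸-monoˡ-≤ (P i) (proj₂ (step i i<M))) (≤-reflexive (m+n∸m≡n (P i) mm))

  far : ∀ i j → 2 + i ≤ j → j ≤ M → suc mm ≤ P j ∸ P i
  far i j 2+i≤j j≤M = ≤-trans (≤-reflexive (sym (m+n∸m≡n (P i) (suc mm))))
    (∸-monoˡ-≤ (P i) (≤-trans (skip i (≤-trans 2+i≤j j≤M)) (mono (2 + i) j 2+i≤j j≤M)))

  inner : ∀ i j → i < j → j ≤ M → ¬ (i ≡ 0 × j ≡ M) → P j ∸ P i < P M ∸ P 0
  inner zero j 0<j j≤M not-whole =
    ∸-monoˡ-< (strict j M (≤∧≢⇒< j≤M (λ j≡M → not-whole (refl , j≡M))) ≤-refl)
              (mono 0 j z≤n j≤M)
  inner (suc i) j 1+i<j j≤M _ =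
    <-≤-trans (∸-monoʳ-< (strict 0 (suc i) z<s (≤-trans (<⇒≤ 1+i<j) j≤M))
                         (mono (suc i) j (<⇒≤ 1+i<j) j≤M))
              (∸-monoˡ-≤ (P 0) (mono j M j≤M ≤-refl))

stone-division : ∀ mm .{{_ : NonZero mm}} L → suc mm < L →
  Σ ℕ λ q → Σ ℕ λ g → 1 ≤ q × 1 ≤ g × g ≤ mm × L ≡ suc (q * mm + g)
stone-division mm L mm+2≤L =
  q , suc r , m≥n⇒m/n>0 (∸-monoˡ-≤ 2 mm+2≤L) , s≤s z≤n , m%n<n (L ∸ 2) mm , L≡
  where
  q = (L ∸ 2) / mm
  r = (L ∸ 2) % mm
  L≡ : L ≡ suc (q * mm + suc r)
  L≡ = begin
    L                 ≡⟨ sym (m+[n∸m]≡n (≤-trans (s≤s (s≤s z≤n)) mm+2≤L)) ⟩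
    2 + (L ∸ 2)       ≡⟨ cong (2 +_) (m≡m%n+[m/n]*n (L ∸ 2) mm) ⟩
    2 + (r + q * mm)  ≡⟨ cong (2 +_) (+-comm r (q * mm)) ⟩
    2 + (q * mm + r)  ≡⟨ cong suc (sym (+-suc (q * mm) r)) ⟩
    suc (q * mm + suc r) ∎
    where open ≡-Reasoning

-- x + (y + 1) ≤ (y + x) + z whenever z ≥ 1: two-step gaps of the stones
-- exceed mm because every gap is at least 1.
spacing : ∀ x y z → 1 ≤ z → x + suc y ≤ y + x + z
spacing x y z z≥1 = begin
  x + suc y    ≡⟨ +-comm x (suc y) ⟩
  suc (y + x)  ≡⟨ +-comm 1 (y + x) ⟩
  y + x + 1    ≤⟨ +-monoʳ-≤ (y + x) z≥1 ⟩
  y + x + z    ∎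
  where open ≤-Reasoning

-- For L = 1 + q·mm + g the stones 0, 1, 1 + mm, ..., 1 + q·mm, L
-- (indices 0, ..., q + 2) form a gapped chain for mm.
module SteppingStones (mm q g L : ℕ) (mm≥1 : 1 ≤ mm) (q≥1 : 1 ≤ q) (g≥1 : 1 ≤ g)
                      (g≤mm : g ≤ mm) (L≡ : L ≡ suc (q * mm + g)) where

  last : ℕ
  last = suc (suc q)

  stone : ℕ → ℕ
  stone zero = 0
  stone (suc i) with i ≤? q
  ... | yes _ = suc (i * mm)
  ... | no _  = L

  stone-inner : ∀ i → i ≤ q → stone (suc i) ≡ suc (i * mm)
  stone-inner i i≤q with i ≤? q
  ... | yes _ = refl
  ... | no i≰q = ⊥-elim (i≰q i≤q)

  stone-last : stone last ≡ L
  stone-last with suc q ≤? q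
  ... | yes 1+q≤q = ⊥-elim (<-irrefl refl 1+q≤q)
  ... | no _ = refl

  stone-step : ∀ i → i < last → stone i < stone (suc i) × stone (suc i) ≤ stone i + mm
  stone-step zero _ rewrite stone-inner 0 z≤n = z<s , mm≥1
  stone-step (suc i) (s≤s (s≤s i≤q)) with m≤n⇒m<n∨m≡n i≤q
  ... | inj₁ i<q rewrite stone-inner i i≤q | stone-inner (suc i) i<q =
        s≤s (m<n+m (i * mm) mm≥1) , s≤s (≤-reflexive (+-comm mm (i * mm)))
  ... | inj₂ refl rewrite stone-inner i ≤-refl | stone-last | L≡ =
        s≤s (m<m+n (i * mm) g≥1) , s≤s (+-monoʳ-≤ (i * mm) g≤mm)

  stone-skip : ∀ i → 2 + i ≤ last → stone i + suc mm ≤ stone (2 + i)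
  stone-skip zero _ rewrite stone-inner 1 q≥1 = ≤-reflexive (cong suc (sym (+-identityʳ mm)))
  stone-skip (suc i) (s≤s (s≤s 1+i≤q)) rewrite stone-inner i (<⇒≤ 1+i≤q) with m≤n⇒m<n∨m≡n 1+i≤q
  ... | inj₁ 2+i≤q rewrite stone-inner (suc (suc i)) 2+i≤q =
        s≤s (≤-trans (spacing (i * mm) mm mm mm≥1) (≤-reflexive (+-comm (suc i * mm) mm)))
  ... | inj₂ 1+i≡q = begin
        suc (i * mm) + suc mm  ≤⟨ s≤s (spacing (i * mm) mm g g≥1) ⟩
        suc (suc i * mm + g)   ≡⟨ cong (λ m → suc (m * mm + g)) 1+i≡q ⟩
        suc (q * mm + g)       ≡⟨ sym L≡ ⟩
        L                      ≡⟨ subst (λ m → L ≡ stone (suc (suc m))) (sym 1+i≡q) (sym stone-last) ⟩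
        stone (3 + i)          ∎
    where open ≤-Reasoning

skipping : ∀ {x y} → x < y → y ≢ suc x → 2 + x ≤ y
skipping x<y y≢1+x = ≤∧≢⇒< x<y (y≢1+x ∘ sym)

module Orbit (n : ℕ) .{{_ : NonZero n}} (S : ℕ → Set) (a : ℕ) where

  k : ℕ
  k = ord n a

  mult : ℕ → ℕ
  mult x = mulMod n x a

  vertex : ℕ → Fin n
  vertex x = fromℕ< (m%n<n (x * a) n)

  toℕ-vertex : ∀ x → toℕ (vertex x) ≡ mult x
  toℕ-vertex x = toℕ-fromℕ< (m%n<n (x * a) n)

  MultInS : ℕ → Set
  MultInS x = S (labDist n (mult x))

  -- y·a = x·a + (y - x)·a in ℤ_n, so orbit distances depend only on y - x
  mult-split : ∀ x y → x ≤ y → mult y ≡ (mult x + mult (y ∸ x)) % n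
  mult-split x y x≤y = begin
    (y * a) % n                     ≡⟨ cong (λ z → (z * a) % n) (sym (m+[n∸m]≡n x≤y)) ⟩
    ((x + (y ∸ x)) * a) % n         ≡⟨ cong (_% n) (*-distribʳ-+ a x (y ∸ x)) ⟩
    (x * a + (y ∸ x) * a) % n       ≡⟨ %-distribˡ-+ (x * a) ((y ∸ x) * a) n ⟩
    (mult x + mult (y ∸ x)) % n     ∎
    where open ≡-Reasoning

  orbit-distance : ∀ x y → x ≤ y → cdist n (mult x) (mult y) ≡ labDist n (mult (y ∸ x))
  orbit-distance x y x≤y rewrite mult-split x y x≤y =
    proj₁ (cdist-shift n (mult x) (mult (y ∸ x)) (m%n<n (x * a) n) (m%n<n ((y ∸ x) * a) n))

  orbit-collision : ∀ x y → x ≤ y → mult x ≡ mult y → mult (y ∸ x) ≡ 0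
  orbit-collision x y x≤y rewrite mult-split x y x≤y =
    proj₂ (cdist-shift n (mult x) (mult (y ∸ x)) (m%n<n (x * a) n) (m%n<n ((y ∸ x) * a) n))

  adjacency : ∀ x y → x ≤ y → Adj n S (vertex x) (vertex y) ≡ MultInS (y ∸ x)
  adjacency x y x≤y =
    cong S (trans (cong₂ (cdist n) (toℕ-vertex x) (toℕ-vertex y)) (orbit-distance x y x≤y))

  adjacent : ∀ x y → x ≤ y → MultInS (y ∸ x) → Adj n S (vertex x) (vertex y)
  adjacent x y x≤y = subst id (sym (adjacency x y x≤y))

  edge-gap : ∀ x y → x ≤ y → Adj n S (vertex x) (vertex y) → MultInS (y ∸ x)
  edge-gap x y x≤y = subst id (adjacency x y x≤y)

  mult-injective : ∀ x y → x < y → y < k → mult x ≢ mult y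
  mult-injective x y x<y y<k collide =
    proj₂ (ord-spec n a) (y ∸ x) (m<n⇒0<n∸m x<y) (≤-<-trans (m∸n≤m y x) y<k)
      (orbit-collision x y (<⇒≤ x<y) collide)

  -- (k - d)·a = -(d·a) has the same labelling distance as d·a
  MultInS-reflect : ∀ d → d ≤ k → MultInS d → MultInS (k ∸ d)
  MultInS-reflect d d≤k = subst S (begin
    labDist n (mult d)              ≡⟨ cong (labDist n ∘ mult) (sym (m∸[m∸n]≡n d≤k)) ⟩
    labDist n (mult (k ∸ (k ∸ d)))  ≡⟨ sym (orbit-distance (k ∸ d) k (m∸n≤m k d)) ⟩
    cdist n (mult (k ∸ d)) (mult k) ≡⟨ cong (cdist n (mult (k ∸ d))) (proj₁ (ord-spec n a)) ⟩
    labDist n (mult (k ∸ d))        ∎)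
    where open ≡-Reasoning

  -- a itself lies in T, so it is its own labelling distance
  generator-in-S : IsConnSet n S → S a → MultInS 1
  generator-in-S conn a∈S =
    subst S (sym (trans (cong (labDist n) mult1≡a) (labDist-half n a a≤n/2))) a∈S
    where
    a≤n/2 : a ≤ n / 2
    a≤n/2 = proj₂ (conn a a∈S)
    a<n : a < n
    a<n = <-≤-trans (m<m+n a (proj₁ (conn a a∈S))) (double-half n a a≤n/2)
    mult1≡a : mult 1 ≡ a
    mult1≡a = trans (cong (_% n) (*-identityˡ a)) (m<n⇒m%n≡m a<n)

  orbit-cycle : ∀ M (P : ℕ → ℕ) →
    (∀ i j → i ≤ j → j ≤ M → P i ≤ P j) → (∀ i j → i < j → j ≤ M → P i < P j) →
    (∀ i → i ≤ M → P i < k) → (∀ i → i < M → MultInS (P (suc i) ∸ P i)) →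
    MultInS (P M ∸ P 0) → IsCycle n S M (λ i → vertex (P (toℕ i)))
  orbit-cycle M P mono strict below-k edge span = injective , path , closing
    where
    at : Fin (suc M) → ℕ
    at i = P (toℕ i)
    distinct : ∀ i j → toℕ i < toℕ j → vertex (at i) ≢ vertex (at j)
    distinct i j i<j same = mult-injective (at i) (at j) (strict _ _ i<j (≤-pred (toℕ<n j)))
      (below-k _ (≤-pred (toℕ<n j)))
      (trans (sym (toℕ-vertex (at i))) (trans (cong toℕ same) (toℕ-vertex (at j))))
    injective : ∀ {i j} → vertex (at i) ≡ vertex (at j) → i ≡ j
    injective {i} {j} same with <-cmp (toℕ i) (toℕ j)
    ... | tri< i<j _ _ = ⊥-elim (distinct i j i<j same)
    ... | tri≈ _ i≡j _ = toℕ-injective i≡j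
    ... | tri> _ _ j<i = ⊥-elim (distinct j i j<i (sym same))
    path : ∀ (i : Fin M) → Adj n S (vertex (at (inject₁ i))) (vertex (at (fsuc i)))
    path i rewrite toℕ-inject₁ i = adjacent _ _ P[i]≤P[1+i] (edge (toℕ i) (toℕ<n i))
      where
      P[i]≤P[1+i] : P (toℕ i) ≤ P (suc (toℕ i))
      P[i]≤P[1+i] = mono _ _ (n≤1+n _) (toℕ<n i)
    closing : Adj n S (vertex (at (fromℕ M))) (vertex (at fzero))
    closing rewrite toℕ-fromℕ M =
      Adj-sym n S (vertex (P 0)) (vertex (P M)) (adjacent _ _ (mono 0 M z≤n ≤-refl) span)

  chord-gap : ∀ M (P : ℕ → ℕ) → (∀ i j → i ≤ j → j ≤ M → P i ≤ P j) →
    HasChord n S M (λ i → vertex (P (toℕ i))) →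
    Σ ℕ λ i → Σ ℕ λ j → 2 + i ≤ j × j ≤ M × ¬ (i ≡ 0 × j ≡ M) × MultInS (P j ∸ P i)
  chord-gap M P mono (i , j , i≢j , not-consecutive , adj) with <-cmp (toℕ i) (toℕ j)
  ... | tri≈ _ i≡j _ = ⊥-elim (i≢j (toℕ-injective i≡j))
  ... | tri< i<j _ _ = toℕ i , toℕ j ,
          skipping i<j (not-consecutive ∘ inj₁) , ≤-pred (toℕ<n j) ,
          (λ (i≡0 , j≡M) → not-consecutive (inj₂ (inj₂ (inj₁ (i≡0 , j≡M))))) ,
          edge-gap _ _ (mono _ _ (<⇒≤ i<j) (≤-pred (toℕ<n j))) adj
  ... | tri> _ _ j<i = toℕ j , toℕ i ,
          skipping j<i (not-consecutive ∘ inj₂ ∘ inj₁) , ≤-pred (toℕ<n i) ,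
          (λ (j≡0 , i≡M) → not-consecutive (inj₂ (inj₂ (inj₂ (i≡M , j≡0))))) ,
          edge-gap _ _ (mono _ _ (<⇒≤ j<i) (≤-pred (toℕ<n i)))
            (Adj-sym n S (vertex (P (toℕ i))) (vertex (P (toℕ j))) adj)

  module UnderChordality (chordal : Chordal n S) where

    -- If d·a ∈ S for 1 ≤ d < t and L·a ∈ S with t < L < k, then D·a ∈ S
    -- for some t ≤ D < L: the chord of the stepping-stone cycle.
    shorter-multiple : ∀ t → 2 ≤ t → (∀ d → 1 ≤ d → d < t → MultInS d) →
      ∀ L → t < L → L < k → MultInS L → Σ ℕ λ D → t ≤ D × D < L × MultInS D
    shorter-multiple (suc mm) (s≤s mm≥1) below L t<L L<k L∈S
      with stone-division mm {{>-nonZero mm≥1}} L t<L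
    ... | q , g , q≥1 , g≥1 , g≤mm , L≡ =
      shorten (chord-gap last stone mono (chordal last (s≤s (s≤s q≥1)) _ cycle))
      where
      open SteppingStones mm q g L mm≥1 q≥1 g≥1 g≤mm L≡
      open GappedChain mm last stone stone-step stone-skip
      cycle : IsCycle n S last (λ i → vertex (stone (toℕ i)))
      cycle = orbit-cycle last stone mono strict
        (λ i i≤last → ≤-<-trans (mono i last i≤last ≤-refl) (subst (_< k) (sym stone-last) L<k))
        (λ i i<last → below _ (proj₁ (near i i<last)) (s≤s (proj₂ (near i i<last))))
        (subst MultInS (sym stone-last) L∈S)
      shorten : (Σ ℕ λ i → Σ ℕ λ j → 2 + i ≤ j × j ≤ last × ¬ (i ≡ 0 × j ≡ last) ×
                  MultInS (stone j ∸ stone i)) →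
                Σ ℕ λ D → suc mm ≤ D × D < L × MultInS D
      shorten (i , j , 2+i≤j , j≤last , not-span , gap∈S) =
        stone j ∸ stone i , far i j 2+i≤j j≤last ,
        subst (stone j ∸ stone i <_) stone-last
          (inner i j (≤-trans (n≤1+n _) 2+i≤j) j≤last not-span) ,
        gap∈S

    descend-to : ∀ t → 2 ≤ t → (∀ d → 1 ≤ d → d < t → MultInS d) →
      ∀ L → t ≤ L → L < k → MultInS L → MultInS t
    descend-to t 2≤t below = <-rec (λ L → t ≤ L → L < k → MultInS L → MultInS t) descend
      where
      descend : ∀ L → (∀ {L′} → L′ < L → t ≤ L′ → L′ < k → MultInS L′ → MultInS t) →
                t ≤ L → L < k → MultInS L → MultInS t
      descend L shorter t≤L L<k L∈S with m≤n⇒m<n∨m≡n t≤L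
      ... | inj₂ t≡L = subst MultInS (sym t≡L) L∈S
      ... | inj₁ t<L with shorter-multiple t 2≤t below L t<L L<k L∈S
      ... | D , t≤D , D<L , D∈S = shorter D<L t≤D (<-trans D<L L<k) D∈S

    all-multiples-in-S : MultInS 1 → MultInS (k ∸ 1) → ∀ t → 1 ≤ t → t < k → MultInS t
    all-multiples-in-S 1∈S [k-1]∈S = <-rec (λ t → 1 ≤ t → t < k → MultInS t) induct
      where
      induct : ∀ t → (∀ {s} → s < t → 1 ≤ s → s < k → MultInS s) → 1 ≤ t → t < k → MultInS t
      induct (suc zero) _ _ _ = 1∈S
      induct t@(suc (suc _)) smaller _ t<k =
        descend-to t (s≤s (s≤s z≤n)) (λ d d≥1 d<t → smaller d<t d≥1 (<-trans d<t t<k))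
          (k ∸ 1) (∸-monoˡ-≤ 1 t<k) (∸-monoʳ-< z<s (≤-trans (s≤s z≤n) t<k)) [k-1]∈S

-- Chordality would put every d·a with 1 ≤ d < k into S, including j·a.
lemma2p2 : (n : ℕ) → .{{_ : NonZero n}} → (S : ℕ → Set) → IsConnSet n S →
    (a : ℕ) → S a → 4 ≤ ord n a →
    Σ ℕ (λ j → (1 ≤ j) × (j ≤ ord n a / 2) × ¬ S (labDist n (mulMod n j a))) →
    ¬ Chordal n S
lemma2p2 n S conn a a∈S k≥4 (j , j≥1 , j≤k/2 , j·a∉S) chordal =
  j·a∉S (all-multiples-in-S 1·a∈S (MultInS-reflect 1 k≥1 1·a∈S) j j≥1 j<k)
  where
  open Orbit n S a
  open UnderChordality chordal
  k≥1 : 1 ≤ k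
  k≥1 = ≤-trans (s≤s z≤n) k≥4
  1·a∈S : MultInS 1
  1·a∈S = generator-in-S conn a∈S
  j<k : j < k
  j<k = ≤-<-trans j≤k/2 (m/n<m k 2 {{>-nonZero k≥1}} (s≤s (s≤s z≤n)))
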